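{- Let $r\geq 3$ and $\alpha$ be positive integers, let $\mathcal H$ be an $r$-uniform $r$-partite hypergraph and let $\mathcal A$ be an $\alpha$-core of $\mathcal H$. Let $F$ be a graph with $E(F)\neq\emptyset$ and $|V(F)|\leq \alpha$, and suppose $\mathcal A$ contains an induced Berge $F$. Let $F^+$ be the graph obtained from $F$ by adding a new vertex $z\notin V(F)$, choosing an edge $xy\in E(F)$, and joining $z$ to $x$ and to $y$. Then $\mathcal A$ also contains an induced Berge $F^+$.
   Context: An $r$-uniform hypergraph is a family of $r$-element subsets (edges) of a finite vertex set; it is $r$-partite if its vertex set is partitioned into $r$ parts with every edge meeting each part in exactly one vertex. For a set $S$ of vertices, $\deg_{\mathcal A}(S)$ is the number of edges of $\mathcal A$ containing $S$. An $\alpha$-core of $\mathcal H$ is any subfamily $\mathcal A\subseteq\mathcal H$ such that for every $(r-1)$-element vertex set $S$, either $\deg_{\mathcal A}(S)=0$ or $\deg_{\mathcal A}(S)\ge\alpha$. For a graph $F$ with vertex set $\{v_1,\dots,v_p\}$ and edge set $\{e_1,\dots,e_q\}$, a hypergraph contains an induced Berge $F$ if there exist distinct vertices $W=\{w_1,\dots,w_p\}$ and distinct edges $f_1,\dots,f_q$ of it such that whenever $e_i=v_\alpha v_\beta$ we have $f_i\cap W=\{w_\alpha,w_\beta\}$. -}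

module Defs where

open import Data.Nat using (ℕ; zero; suc; _∸_; _≤_)
open import Data.Fin using (Fin; zero; suc)
open import Data.Fin.Subset using (Subset; _∈_; _⊆_; ∣_∣)
open import Data.Fin.Subset.Properties using (_⊆?_)
open import Data.List using (List; length; filter)
open import Data.List.Relation.Unary.All using (All)
open import Data.List.Relation.Unary.Unique.Propositional using (Unique)
import Data.List.Membership.Propositional as LM
open import Data.Product using (Σ; ∃; ∃-syntax; _×_; _,_; proj₁; proj₂)
open import Data.Sum using (_⊎_)
open import Relation.Binary.PropositionalEquality using (_≡_; _≢_)
open import Function.Definitions using (Injective)
open import Function.Bundles using (_⇔_)

record Family (n : ℕ) : Set where
  field
    edges  : List (Subset n)
    unique : Unique edges
open Family public

_∈ₑ_ : ∀ {n} → Subset n → Family n → Set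
e ∈ₑ H = LM._∈_ e (edges H)

_⊑_ : ∀ {n} → Family n → Family n → Set
A ⊑ H = All (λ e → e ∈ₑ H) (edges A)

-- r-uniform and r-partite with respect to the partition given by `part`
-- (vertex v lies in part `part v`): every edge has exactly r vertices and
-- meets each part in exactly one vertex.
IsUniformPartite : ∀ {n} (r : ℕ) → (Fin n → Fin r) → Family n → Set
IsUniformPartite {n} r part H =
  ∀ e → e ∈ₑ H →
    (∣ e ∣ ≡ r) ×
    (∀ (i : Fin r) → ∃[ v ] ((v ∈ e × part v ≡ i) ×
                              (∀ u → u ∈ e → part u ≡ i → u ≡ v)))

deg : ∀ {n} → Family n → Subset n → ℕ
deg A S = length (filter (S ⊆?_) (edges A))

IsCore : ∀ {n} (r α : ℕ) → Family n → Set
IsCore {n} r α A =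
  ∀ (S : Subset n) → ∣ S ∣ ≡ r ∸ 1 → (deg A S ≡ 0) ⊎ (α ≤ deg A S)

record Graph : Set where
  field
    p    : ℕ
    q    : ℕ
    ends : Fin q → Fin p × Fin p
open Graph public

IsSimple : Graph → Set
IsSimple F =
  (∀ i → proj₁ (ends F i) ≢ proj₂ (ends F i)) ×
  (∀ i j → ((proj₁ (ends F i) ≡ proj₁ (ends F j) × proj₂ (ends F i) ≡ proj₂ (ends F j))
           ⊎ (proj₁ (ends F i) ≡ proj₂ (ends F j) × proj₂ (ends F i) ≡ proj₁ (ends F j)))
           → i ≡ j)

-- induced Berge F in the family 𝒜: distinct vertices w₁…w_p and distinct
-- edges f₁…f_q of 𝒜 with f_i ∩ W = {w_a, w_b} whenever e_i = v_a v_b.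
InducedBerge : ∀ {n} → Graph → Family n → Set
InducedBerge {n} F A =
  Σ (Fin (p F) → Fin n) λ w →
  Σ (Fin (q F) → Subset n) λ f →
    Injective _≡_ _≡_ w ×
    Injective _≡_ _≡_ f ×
    (∀ i → f i ∈ₑ A) ×
    (∀ i (v : Fin n) →
       ((v ∈ f i × ∃[ k ] (w k ≡ v)) ⇔
        (v ≡ w (proj₁ (ends F i)) ⊎ v ≡ w (proj₂ (ends F i)))))

-- F⁺: add a new vertex z (index zero; old vertex v becomes suc v) and the
-- two edges z x, z y where x y are the endpoints of the chosen edge j.
-- New edges get indices zero, suc zero; old edge i becomes suc (suc i).
plus : (F : Graph) → Fin (q F) → Graph
plus F j = record
  { p = suc (p F)
  ; q = suc (suc (q F))
  ; ends = e⁺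
  }
  where
  e⁺ : Fin (suc (suc (q F))) → Fin (suc (p F)) × Fin (suc (p F))
  e⁺ zero          = zero , suc (proj₁ (ends F j))
  e⁺ (suc zero)    = zero , suc (proj₂ (ends F j))
  e⁺ (suc (suc i)) = suc (proj₁ (ends F i)) , suc (proj₂ (ends F i))

-- Write x, y for the ends of the chosen edge. Since r ≥ 3, the hyperedge f_j has a vertex u in a
-- part containing neither w_x nor w_y, and u is not a branch vertex. The key fact is an exchange
-- property of α-cores of r-partite hypergraphs: for an edge e and t ∈ e, the edges through the
-- (r-1)-set e - t are exactly the sets (e - t) + v with v in the part of t, and there are at least
-- α of them. So t can be exchanged for a vertex outside any list having fewer than α members
-- outside e - t; since each edge involved contains two branch vertices, the p ≤ α branch
-- vertices (plus t itself, when t is not one of them) form such a list. Exchanging u in f_j gives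
-- an edge g = f_j - u + z with a new branch vertex z; exchanging w_y, respectively w_x, in g gives
-- the two edges z w_x and z w_y of F⁺; and every old edge that contains z exchanges z for a vertex
-- outside the copy. Distinctness of the new edges is automatic: in an induced Berge copy of a
-- simple graph, distinct edges have distinct traces.

module Submission where

open import Defs
open import Data.Nat using (ℕ; suc; _≤_; _<_; _+_; _∸_; z≤n; s≤s)
open import Data.Nat.Properties
  using (≤-trans; +-comm; +-suc; +-monoˡ-≤; n<1+n; <⇒≢; <⇒≱; module ≤-Reasoning)
open import Data.Bool.Properties using () renaming (_≟_ to _≟ᵇ_)
open import Data.Fin using (Fin; zero; suc)
open import Data.Fin.Properties using (_≟_; suc-injective)
open import Data.Fin.Subset using (Subset; inside; outside; _-_; _∪_; ⁅_⁆; ∣_∣; _∈_; _∉_; _⊆_)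
open import Data.Fin.Subset.Properties
  using (_⊆?_; _∈?_; ⊆-antisym; p─q⊆p; p─⊥≡p; x∈p∧x≢y⇒x∈p-y; x∈p∪q⁺; x∈p∪q⁻; x∈⁅x⁆; x∈⁅y⁆⇒x≡y)
open import Data.Vec.Base using (_∷_; here; there)
open import Data.Vec.Properties using (≡-dec)
open import Data.Vec.Functional using () renaming (_∷_ to _◃_)
open import Data.List using (List; []; _∷_; length; filter; map; allFin; tabulate; _++_)
open import Data.List.Properties using (length-map; length-++; length-tabulate; length-removeAt′)
open import Data.List.Relation.Unary.All using (All; []; _∷_; all?) renaming (lookup to All-lookup)
open import Data.List.Relation.Unary.All.Properties.Core using (¬All⇒Any¬)
open import Data.List.Relation.Unary.Any using (here; there; index)
open import Data.List.Relation.Unary.AllPairs using ([]; _∷_)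
open import Data.List.Relation.Unary.Unique.Propositional using (Unique)
open import Data.List.Relation.Unary.Unique.Propositional.Properties using (++⁺; filter⁺; allFin⁺)
open import Data.List.Membership.Propositional
  using (_─_; find) renaming (_∈_ to _∈ₗ_; _∉_ to _∉ₗ_)
open import Data.List.Membership.Propositional.Properties
  using (∈-filter⁺; ∈-filter⁻; ∈-map⁺; ∈-allFin; ∈-++⁻; ∈-tabulate⁺; ∈-length)
open import Data.List.Relation.Binary.Subset.Propositional using () renaming (_⊆_ to _⊆ₗ_)
open import Data.Product using (Σ-syntax; ∃-syntax; _×_; _,_; proj₁; proj₂)
open import Data.Sum using (_⊎_; inj₁; inj₂; [_,_]′) renaming (swap to ⊎-swap; map to ⊎-map)
open import Data.Empty using (⊥-elim)
open import Function using (_∘_)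
open import Relation.Nullary using (¬_; yes; no; ¬?; _×-dec_; contradiction)
open import Relation.Unary using (Decidable)
open import Relation.Binary.PropositionalEquality using (_≡_; _≢_; refl; sym; trans; cong; subst)
open import Function.Definitions using (Injective)
open import Function.Bundles using (_⇔_; mk⇔; Equivalence)

private
  variable
    m n r : ℕ

x∈p-y⇒x≢y : ∀ {p : Subset n} {x y} → x ∈ p - y → x ≢ y
x∈p-y⇒x≢y {p = _ ∷ p} {y = zero} (there _) ()
x∈p-y⇒x≢y {p = _ ∷ p} {y = suc y} here ()
x∈p-y⇒x≢y {p = _ ∷ p} {y = suc y} (there x∈p-y) refl = x∈p-y⇒x≢y x∈p-y refl

x∈p⇒suc∣p-x∣≡∣p∣ : ∀ {p : Subset n} {x} → x ∈ p → suc ∣ p - x ∣ ≡ ∣ p ∣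
x∈p⇒suc∣p-x∣≡∣p∣ {p = inside  ∷ p} {zero}  here          = cong (suc ∘ ∣_∣) (p─⊥≡p p)
x∈p⇒suc∣p-x∣≡∣p∣ {p = outside ∷ p} {suc x} (there x∈p) = x∈p⇒suc∣p-x∣≡∣p∣ x∈p
x∈p⇒suc∣p-x∣≡∣p∣ {p = inside  ∷ p} {suc x} (there x∈p) = cong suc (x∈p⇒suc∣p-x∣≡∣p∣ x∈p)

infixl 30 _[_≔_]
_[_≔_] : Subset n → Fin n → Fin n → Subset n
e [ t ≔ v ] = (e - t) ∪ ⁅ v ⁆

module _ {e : Subset n} {t v : Fin n} where

  ∈-exchange⁻ : ∀ {u} → u ∈ e [ t ≔ v ] → u ≡ v ⊎ (u ∈ e × u ≢ t)
  ∈-exchange⁻ u∈ with x∈p∪q⁻ (e - t) ⁅ v ⁆ u∈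
  ... | inj₁ u∈e-t = inj₂ (p─q⊆p e ⁅ t ⁆ u∈e-t , x∈p-y⇒x≢y u∈e-t)
  ... | inj₂ u∈⁅v⁆ = inj₁ (x∈⁅y⁆⇒x≡y v u∈⁅v⁆)

  ∈-exchange⁺ˡ : ∀ {u} → u ∈ e → u ≢ t → u ∈ e [ t ≔ v ]
  ∈-exchange⁺ˡ u∈e u≢t = x∈p∪q⁺ (inj₁ (x∈p∧x≢y⇒x∈p-y u∈e u≢t))

  ∈-exchange⁺ʳ : v ∈ e [ t ≔ v ]
  ∈-exchange⁺ʳ = x∈p∪q⁺ (inj₂ (x∈⁅x⁆ v))

module _ {A : Set} where

  ∈-─ : ∀ {x y} {ys : List A} (x∈ys : x ∈ₗ ys) → y ∈ₗ ys → y ≢ x → y ∈ₗ ys ─ x∈ys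
  ∈-─ (here refl)  (here refl)  y≢x = ⊥-elim (y≢x refl)
  ∈-─ (here refl)  (there y∈ys) _   = y∈ys
  ∈-─ (there x∈ys) (here refl)  _   = here refl
  ∈-─ (there x∈ys) (there y∈ys) y≢x = there (∈-─ x∈ys y∈ys y≢x)

  Unique∧⊆⇒length≤ : ∀ {xs ys : List A} → Unique xs → xs ⊆ₗ ys → length xs ≤ length ys
  Unique∧⊆⇒length≤ {[]}     _                 _     = z≤n
  Unique∧⊆⇒length≤ {x ∷ xs} {ys} (x≢xs ∷ uxs) xs⊆ys = begin
    suc (length xs)          ≤⟨ s≤s (Unique∧⊆⇒length≤ uxs xs⊆ys─x) ⟩
    suc (length (ys ─ x∈ys)) ≡⟨ sym (length-removeAt′ ys (index x∈ys)) ⟩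
    length ys                ∎
    where
    open ≤-Reasoning
    x∈ys : x ∈ₗ ys
    x∈ys = xs⊆ys (here refl)
    xs⊆ys─x : xs ⊆ₗ ys ─ x∈ys
    xs⊆ys─x y∈xs = ∈-─ x∈ys (xs⊆ys (there y∈xs)) (All-lookup x≢xs y∈xs ∘ sym)

-- Embeddings and traces

Image : (Fin m → Fin n) → Fin n → Set
Image w v = ∃[ k ] (w k ≡ v)

Image-◃⁻ : ∀ {w : Fin m → Fin n} {z v} → Image (z ◃ w) v → v ≡ z ⊎ Image w v
Image-◃⁻ (zero  , z≡v)  = inj₁ (sym z≡v)
Image-◃⁻ (suc k , wk≡v) = inj₂ (k , wk≡v)

◃-injective : ∀ {w : Fin m → Fin n} {z} → Injective _≡_ _≡_ w → ¬ Image w z →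
              Injective _≡_ _≡_ (z ◃ w)
◃-injective w-inj z∉w {zero}  {zero}  _  = refl
◃-injective w-inj z∉w {zero}  {suc l} eq = ⊥-elim (z∉w (l , sym eq))
◃-injective w-inj z∉w {suc k} {zero}  eq = ⊥-elim (z∉w (k , eq))
◃-injective w-inj z∉w {suc k} {suc l} eq = cong suc (w-inj eq)

Trace : (Fin m → Fin n) → Subset n → Fin n → Fin n → Set
Trace w e a b = ∀ v → (v ∈ e × Image w v) ⇔ (v ≡ a ⊎ v ≡ b)

module _ {w : Fin m → Fin n} {e : Subset n} {a b : Fin n} (tr : Trace w e a b) where

  Trace-sym : Trace w e b a
  Trace-sym v = mk⇔ (⊎-swap ∘ Equivalence.to (tr v)) (Equivalence.from (tr v) ∘ ⊎-swap)

  Trace⇒∈ˡ : a ∈ e × Image w a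
  Trace⇒∈ˡ = Equivalence.from (tr a) (inj₁ refl)

  Trace⇒∈ʳ : b ∈ e × Image w b
  Trace⇒∈ʳ = Equivalence.from (tr b) (inj₂ refl)

  Trace-◃ : ∀ {z} → z ∉ e → Trace (z ◃ w) e a b
  Trace-◃ {z} z∉e v = mk⇔ to (λ v≡ → let (v∈e , k , wk≡v) = Equivalence.from (tr v) v≡
                                     in v∈e , suc k , wk≡v)
    where
    to : v ∈ e × Image (z ◃ w) v → v ≡ a ⊎ v ≡ b
    to (v∈e , img) with Image-◃⁻ img
    ... | inj₁ refl = contradiction v∈e z∉e
    ... | inj₂ img′ = Equivalence.to (tr v) (v∈e , img′)

  Trace-exchange : ∀ {t v} → ¬ Image w t → ¬ Image w v → Trace w (e [ t ≔ v ]) a b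
  Trace-exchange {t} {v} t∉w v∉w u = mk⇔ to from
    where
    to : u ∈ e [ t ≔ v ] × Image w u → u ≡ a ⊎ u ≡ b
    to (u∈ , img) with ∈-exchange⁻ u∈
    ... | inj₁ refl       = contradiction img v∉w
    ... | inj₂ (u∈e , _) = Equivalence.to (tr u) (u∈e , img)
    from : u ≡ a ⊎ u ≡ b → u ∈ e [ t ≔ v ] × Image w u
    from u≡ = let (u∈e , img) = Equivalence.from (tr u) u≡
              in ∈-exchange⁺ˡ u∈e (λ { refl → t∉w img }) , img

  Trace-exchange-endpoint : ∀ {z v} → z ∈ e → ¬ Image w z → ¬ Image w v → a ≢ b →
                   Trace (z ◃ w) (e [ b ≔ v ]) z a
  Trace-exchange-endpoint {z} {v} z∈e z∉w v∉w a≢b u = mk⇔ to from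
    where
    to : u ∈ e [ b ≔ v ] × Image (z ◃ w) u → u ≡ z ⊎ u ≡ a
    to (u∈ , img) with Image-◃⁻ img | ∈-exchange⁻ u∈
    ... | inj₁ u≡z | _                 = inj₁ u≡z
    ... | inj₂ img′ | inj₁ refl        = contradiction img′ v∉w
    ... | inj₂ img′ | inj₂ (u∈e , u≢b) with Equivalence.to (tr u) (u∈e , img′)
    ...   | inj₁ u≡a = inj₂ u≡a
    ...   | inj₂ u≡b = contradiction u≡b u≢b
    from : u ≡ z ⊎ u ≡ a → u ∈ e [ b ≔ v ] × Image (z ◃ w) u
    from (inj₁ refl) = ∈-exchange⁺ˡ z∈e (λ { refl → z∉w (proj₂ Trace⇒∈ʳ) }) , zero , refl
    from (inj₂ refl) = let (a∈e , k , wk≡a) = Trace⇒∈ˡ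
                       in ∈-exchange⁺ˡ a∈e a≢b , suc k , wk≡a

Parallel : (G : Graph) → Fin (q G) → Fin (q G) → Set
Parallel G i k =
  (proj₁ (ends G i) ≡ proj₁ (ends G k) × proj₂ (ends G i) ≡ proj₂ (ends G k)) ⊎
  (proj₁ (ends G i) ≡ proj₂ (ends G k) × proj₂ (ends G i) ≡ proj₁ (ends G k))

plus-simple : ∀ F j → IsSimple F → IsSimple (plus F j)
plus-simple F j (loopless , parallel-free) = loopless⁺ , parallel-free⁺
  where
  loopless⁺ : ∀ i → proj₁ (ends (plus F j) i) ≢ proj₂ (ends (plus F j) i)
  loopless⁺ zero          ()
  loopless⁺ (suc zero)    ()
  loopless⁺ (suc (suc i)) = loopless i ∘ suc-injective
  parallel-free⁺ : ∀ i k → Parallel (plus F j) i k → i ≡ k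
  parallel-free⁺ zero          zero          _                = refl
  parallel-free⁺ (suc zero)    (suc zero)    _                = refl
  parallel-free⁺ zero          (suc zero)    (inj₁ (_ , x≡y)) = ⊥-elim (loopless j (suc-injective x≡y))
  parallel-free⁺ (suc zero)    zero          (inj₁ (_ , y≡x)) = ⊥-elim (loopless j (suc-injective (sym y≡x)))
  parallel-free⁺ (suc (suc i)) (suc (suc k)) parallel         =
    cong (λ i → suc (suc i)) (parallel-free i k (⊎-map suc-injective² suc-injective² parallel))
    where
    suc-injective² : ∀ {a b c d : Fin (p F)} → Fin.suc a ≡ suc b × Fin.suc c ≡ suc d → a ≡ b × c ≡ d
    suc-injective² (a≡b , c≡d) = suc-injective a≡b , suc-injective c≡d
  parallel-free⁺ zero          (suc zero)    (inj₂ (() , _))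
  parallel-free⁺ (suc zero)    zero          (inj₂ (() , _))
  parallel-free⁺ zero          (suc (suc k)) (inj₁ (() , _))
  parallel-free⁺ zero          (suc (suc k)) (inj₂ (() , _))
  parallel-free⁺ (suc zero)    (suc (suc k)) (inj₁ (() , _))
  parallel-free⁺ (suc zero)    (suc (suc k)) (inj₂ (() , _))
  parallel-free⁺ (suc (suc i)) zero          (inj₁ (() , _))
  parallel-free⁺ (suc (suc i)) zero          (inj₂ (_ , ()))
  parallel-free⁺ (suc (suc i)) (suc zero)    (inj₁ (() , _))
  parallel-free⁺ (suc (suc i)) (suc zero)    (inj₂ (_ , ()))

Trace-injective : ∀ (G : Graph) {w : Fin (p G) → Fin n} {f : Fin (q G) → Subset n} →
  IsSimple G → Injective _≡_ _≡_ w →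
  (∀ i → Trace w (f i) (w (proj₁ (ends G i))) (w (proj₂ (ends G i)))) →
  Injective _≡_ _≡_ f
Trace-injective G {w} {f} (loopless , parallel-free) w-inj tr {i} {k} fi≡fk
  with endpoint-of-k (proj₁ (Trace⇒∈ˡ (tr i))) (proj₂ (Trace⇒∈ˡ (tr i)))
     | endpoint-of-k (proj₁ (Trace⇒∈ʳ (tr i))) (proj₂ (Trace⇒∈ʳ (tr i)))
  where
  endpoint-of-k : ∀ {v} → v ∈ f i → Image w v → v ≡ w (proj₁ (ends G k)) ⊎ v ≡ w (proj₂ (ends G k))
  endpoint-of-k v∈fi img = Equivalence.to (tr k _) (subst (_ ∈_) fi≡fk v∈fi , img)
... | inj₁ a≡a′ | inj₁ b≡a′ = ⊥-elim (loopless i (w-inj (trans a≡a′ (sym b≡a′))))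
... | inj₁ a≡a′ | inj₂ b≡b′ = parallel-free i k (inj₁ (w-inj a≡a′ , w-inj b≡b′))
... | inj₂ a≡b′ | inj₁ b≡a′ = parallel-free i k (inj₂ (w-inj a≡b′ , w-inj b≡a′))
... | inj₂ a≡b′ | inj₂ b≡b′ = ⊥-elim (loopless i (w-inj (trans a≡b′ (sym b≡b′))))

-- Exchanging a vertex of an edge of a core

Transversal : (Fin n → Fin r) → Subset n → Set
Transversal {r = r} part e =
  ∀ (i : Fin r) → ∃[ v ] ((v ∈ e × part v ≡ i) × (∀ u → u ∈ e → part u ≡ i → u ≡ v))

Transversal-injective : ∀ {part : Fin n → Fin r} {e} → Transversal part e →
                        ∀ {u v} → u ∈ e → v ∈ e → part u ≡ part v → u ≡ v
Transversal-injective T {u} {v} u∈e v∈e pu≡pv =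
  let (_ , _ , unique) = T _ in trans (unique u u∈e pu≡pv) (sym (unique v v∈e refl))

third-part : 3 ≤ r → (a b : Fin r) → ∃[ c ] (c ≢ a × c ≢ b)
third-part (s≤s (s≤s (s≤s _))) a b with zero ≟ a | zero ≟ b
... | no 0≢a   | no 0≢b   = zero , 0≢a , 0≢b
... | yes refl | _ with suc zero ≟ b
...   | no 1≢b   = suc zero , (λ ()) , 1≢b
...   | yes refl = suc (suc zero) , (λ ()) , (λ ())
third-part (s≤s (s≤s (s≤s _))) a b | no 0≢a | yes refl with suc zero ≟ a
...   | no 1≢a   = suc zero , 1≢a , (λ ())
...   | yes refl = suc (suc zero) , (λ ()) , (λ ())

-- With at least three parts, some part misses both a and b; the vertex of e there is not embedded.
Trace⇒∃∉Image : ∀ {part : Fin n → Fin r} {w : Fin m → Fin n} {e a b} → 3 ≤ r →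
                Transversal part e → Trace w e a b → ∃[ u ] (u ∈ e × ¬ Image w u)
Trace⇒∃∉Image {part = part} {e = e} {a} {b} r≥3 T tr =
  let (c , c≢pa , c≢pb) = third-part r≥3 (part a) (part b)
      (u , (u∈e , pu≡c) , _) = T c
      u∉w : ¬ Image _ u
      u∉w img = [ (λ u≡a → c≢pa (trans (sym pu≡c) (cong part u≡a)))
                , (λ u≡b → c≢pb (trans (sym pu≡c) (cong part u≡b))) ]′
                (Equivalence.to (tr u) (u∈e , img))
  in u , u∈e , u∉w

module Exchanges {α : ℕ} (part : Fin n → Fin r) (H A : Family n)
  (partite : IsUniformPartite r part H) (A⊑H : A ⊑ H) (core : IsCore r α A) where

  open import Data.List.Membership.DecPropositional (_≟_ {n = n})
    using () renaming (_∈?_ to _∈ₗ?_)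
  open import Data.List.Membership.DecPropositional (≡-dec {n = n} _≟ᵇ_)
    using () renaming (_∈?_ to _∈ₑ?_)

  edge-transversal : ∀ {e} → e ∈ₑ A → Transversal part e
  edge-transversal {e} e∈A = proj₂ (partite e (All-lookup A⊑H e∈A))

  edge-size : ∀ {e} → e ∈ₑ A → ∣ e ∣ ≡ r
  edge-size {e} e∈A = proj₁ (partite e (All-lookup A⊑H e∈A))

  link : Subset n → List (Subset n)
  link S = filter (S ⊆?_) (edges A)

  module _ {e : Subset n} {t : Fin n} (e∈A : e ∈ₑ A) (t∈e : t ∈ e) where

    α≤deg : α ≤ deg A (e - t)
    α≤deg with core (e - t) (trans (cong (_∸ 1) (x∈p⇒suc∣p-x∣≡∣p∣ t∈e)) (cong (_∸ 1) (edge-size e∈A)))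
    ... | inj₂ α≤ = α≤
    ... | inj₁ deg≡0 = contradiction deg≡0 (<⇒≢ (∈-length e∈link) ∘ sym)
      where
      e∈link : e ∈ₗ link (e - t)
      e∈link = ∈-filter⁺ ((e - t) ⊆?_) e∈A (p─q⊆p e ⁅ t ⁆)

    link-edge : ∀ {x v} → x ∈ₑ A → e - t ⊆ x → v ∈ x → part v ≡ part t → x ≡ e [ t ≔ v ]
    link-edge {x} {v} x∈A e-t⊆x v∈x pv≡pt = ⊆-antisym x⊆ ⊇x
      where
      Tx : Transversal part x
      Tx = edge-transversal x∈A
      x⊆ : x ⊆ e [ t ≔ v ]
      x⊆ {u} u∈x with part u ≟ part t
      ... | yes pu≡pt = subst (_∈ e [ t ≔ v ])
                              (sym (Transversal-injective Tx u∈x v∈x (trans pu≡pt (sym pv≡pt))))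
                              ∈-exchange⁺ʳ
      ... | no pu≢pt =
        let (s , (s∈e , ps≡pu) , _) = edge-transversal e∈A (part u)
            s≢t = λ s≡t → pu≢pt (trans (sym ps≡pu) (cong part s≡t))
            u≡s = Transversal-injective Tx u∈x (e-t⊆x (x∈p∧x≢y⇒x∈p-y s∈e s≢t)) (sym ps≡pu)
        in subst (_∈ e [ t ≔ v ]) (sym u≡s) (∈-exchange⁺ˡ s∈e s≢t)
      ⊇x : e [ t ≔ v ] ⊆ x
      ⊇x u∈ with ∈-exchange⁻ u∈
      ... | inj₁ refl        = v∈x
      ... | inj₂ (u∈e , u≢t) = e-t⊆x (x∈p∧x≢y⇒x∈p-y u∈e u≢t)

    Exchangeable : Fin n → Set
    Exchangeable v = v ∉ e - t × e [ t ≔ v ] ∈ₑ A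

    exchangeable? : Decidable Exchangeable
    exchangeable? v = ¬? (v ∈? e - t) ×-dec (e [ t ≔ v ] ∈ₑ? edges A)

    candidates : List (Fin n)
    candidates = filter exchangeable? (allFin n)

    ∈-candidates⁻ : ∀ {v} → v ∈ₗ candidates → Exchangeable v
    ∈-candidates⁻ = proj₂ ∘ ∈-filter⁻ exchangeable? {xs = allFin n}

    candidates-unique : Unique candidates
    candidates-unique = filter⁺ exchangeable? (allFin⁺ n)

    link⊆candidates : link (e - t) ⊆ₗ map (λ v → e [ t ≔ v ]) candidates
    link⊆candidates {x} x∈link =
      let (x∈A , e-t⊆x) = ∈-filter⁻ ((e - t) ⊆?_) x∈link
          (v , (v∈x , pv≡pt) , _) = edge-transversal x∈A (part t)
          x≡ = link-edge x∈A e-t⊆x v∈x pv≡pt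
          v∉e-t = λ v∈e-t → x∈p-y⇒x≢y v∈e-t
            (Transversal-injective (edge-transversal e∈A) (p─q⊆p e ⁅ t ⁆ v∈e-t) t∈e pv≡pt)
      in subst (_∈ₗ map _ candidates) (sym x≡)
           (∈-map⁺ _ (∈-filter⁺ exchangeable? (∈-allFin v) (v∉e-t , subst (_∈ₑ A) x≡ x∈A)))

    α≤#candidates : α ≤ length candidates
    α≤#candidates = begin
      α                                           ≤⟨ α≤deg ⟩
      length (link (e - t))                       ≤⟨ Unique∧⊆⇒length≤ (filter⁺ _ (unique A)) link⊆candidates ⟩
      length (map (λ v → e [ t ≔ v ]) candidates) ≡⟨ length-map _ candidates ⟩
      length candidates                           ∎
      where open ≤-Reasoning

  record Exchange (e : Subset n) (t : Fin n) (B : List (Fin n)) : Set where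
    field
      new         : Fin n
      new∉B       : new ∉ₗ B
      exchanged∈A : e [ t ≔ new ] ∈ₑ A

  -- There are at least α candidates, all outside e - t and hence outside X; were they all in B,
  -- then B would contain at least α + |X| distinct vertices.
  exchange : ∀ {e t} → e ∈ₑ A → t ∈ e → (B X : List (Fin n)) →
             Unique X → All (λ x → x ∈ₗ B × x ∈ e - t) X → length B < α + length X →
             Exchange e t B
  exchange {e} {t} e∈A t∈e B X uX X⊆ |B|< with all? (_∈ₗ? B) (candidates e∈A t∈e)
  ... | no ¬C⊆B = let (v , v∈C , v∉B) = find (¬All⇒Any¬ (_∈ₗ? B) _ ¬C⊆B)
                  in record { new = v ; new∉B = v∉B
                            ; exchanged∈A = proj₂ (∈-candidates⁻ e∈A t∈e v∈C) }
  ... | yes C⊆B = contradiction (≤-trans α+|X|≤|X++C| (Unique∧⊆⇒length≤ X++C-unique X++C⊆B)) (<⇒≱ |B|<)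
    where
    C : List (Fin n)
    C = candidates e∈A t∈e
    X++C-unique : Unique (X ++ C)
    X++C-unique = ++⁺ uX (candidates-unique e∈A t∈e)
      λ (v∈X , v∈C) → proj₁ (∈-candidates⁻ e∈A t∈e v∈C) (proj₂ (All-lookup X⊆ v∈X))
    X++C⊆B : X ++ C ⊆ₗ B
    X++C⊆B v∈ with ∈-++⁻ X v∈
    ... | inj₁ v∈X = proj₁ (All-lookup X⊆ v∈X)
    ... | inj₂ v∈C = All-lookup C⊆B v∈C
    α+|X|≤|X++C| : α + length X ≤ length (X ++ C)
    α+|X|≤|X++C| = begin
      α + length X        ≤⟨ +-monoˡ-≤ (length X) (α≤#candidates e∈A t∈e) ⟩
      length C + length X ≡⟨ +-comm (length C) (length X) ⟩
      length X + length C ≡⟨ length-++ X ⟨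
      length (X ++ C)     ∎
      where open ≤-Reasoning

-- Adding a triangle on an edge

module Extension {α : ℕ} (r≥3 : 3 ≤ r) (part : Fin n → Fin r) (H A : Family n)
  (partite : IsUniformPartite r part H) (A⊑H : A ⊑ H) (core : IsCore r α A)
  (F : Graph) (simple : IsSimple F) (p≤α : p F ≤ α)
  (w : Fin (p F) → Fin n) (f : Fin (q F) → Subset n) (w-inj : Injective _≡_ _≡_ w)
  (f∈A : ∀ i → f i ∈ₑ A)
  (trace : ∀ i → Trace w (f i) (w (proj₁ (ends F i))) (w (proj₂ (ends F i))))
  (j : Fin (q F)) where

  open Exchanges part H A partite A⊑H core
  open Exchange

  W : List (Fin n)
  W = tabulate w

  ∉W⇒¬Image : ∀ {v} → v ∉ₗ W → ¬ Image w v
  ∉W⇒¬Image v∉W (k , refl) = v∉W (∈-tabulate⁺ k)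

  |W|<α+1 : length W < α + 1
  |W|<α+1 = begin-strict
    length W  ≡⟨ length-tabulate w ⟩
    p F       <⟨ n<1+n (p F) ⟩
    suc (p F) ≡⟨ +-comm 1 (p F) ⟩
    p F + 1   ≤⟨ +-monoˡ-≤ 1 p≤α ⟩
    α + 1     ∎
    where open ≤-Reasoning

  |v∷W|<α+2 : ∀ v → length (v ∷ W) < α + 2
  |v∷W|<α+2 v = subst (length (v ∷ W) <_) (sym (+-suc α 1)) (s≤s |W|<α+1)

  ∉Image⇒≢ : ∀ {u v} → Image w u → ¬ Image w v → u ≢ v
  ∉Image⇒≢ img v∉w refl = v∉w img

  exchange-unembedded : ∀ {e t a b} → e ∈ₑ A → t ∈ e → ¬ Image w t →
                        Trace w e (w a) (w b) → w a ≢ w b → Exchange e t (t ∷ W)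
  exchange-unembedded {e} {t} {a} {b} e∈A t∈e t∉w tr wa≢wb =
    exchange e∈A t∈e (t ∷ W) (w a ∷ w b ∷ []) ((wa≢wb ∷ []) ∷ [] ∷ [])
      ( (there (∈-tabulate⁺ a) , x∈p∧x≢y⇒x∈p-y (proj₁ (Trace⇒∈ˡ tr)) (∉Image⇒≢ (a , refl) t∉w))
      ∷ (there (∈-tabulate⁺ b) , x∈p∧x≢y⇒x∈p-y (proj₁ (Trace⇒∈ʳ tr)) (∉Image⇒≢ (b , refl) t∉w)) ∷ [])
      (|v∷W|<α+2 t)

  exchange-endpoint : ∀ {e a b} → e ∈ₑ A → Trace w e (w a) (w b) → w a ≢ w b →
                      Exchange e (w b) W
  exchange-endpoint {e} {a} {b} e∈A tr wa≢wb =
    exchange e∈A (proj₁ (Trace⇒∈ʳ tr)) W (w a ∷ []) ([] ∷ [])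
      ((∈-tabulate⁺ a , x∈p∧x≢y⇒x∈p-y (proj₁ (Trace⇒∈ˡ tr)) wa≢wb) ∷ []) |W|<α+1

  x y : Fin (p F)
  x = proj₁ (ends F j)
  y = proj₂ (ends F j)

  wx≢wy : w x ≢ w y
  wx≢wy = proj₁ simple j ∘ w-inj

  fresh : ∃[ u ] (u ∈ f j × ¬ Image w u)
  fresh = Trace⇒∃∉Image r≥3 (edge-transversal (f∈A j)) (trace j)

  u : Fin n
  u = proj₁ fresh

  u∉w : ¬ Image w u
  u∉w = proj₂ (proj₂ fresh)

  first : Exchange (f j) u (u ∷ W)
  first = exchange-unembedded (f∈A j) (proj₁ (proj₂ fresh)) u∉w (trace j) wx≢wy

  z : Fin n
  z = new first

  z∉w : ¬ Image w z
  z∉w = ∉W⇒¬Image (new∉B first ∘ there)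

  g : Subset n
  g = f j [ u ≔ z ]

  trace-g : Trace w g (w x) (w y)
  trace-g = Trace-exchange (trace j) u∉w z∉w

  zx : Exchange g (w y) W
  zx = exchange-endpoint (exchanged∈A first) trace-g wx≢wy

  zy : Exchange g (w x) W
  zy = exchange-endpoint (exchanged∈A first) (Trace-sym trace-g) (wx≢wy ∘ sym)

  OldEdge : Fin (q F) → Set
  OldEdge i = Σ[ h ∈ Subset n ] (h ∈ₑ A × Trace (z ◃ w) h (w (proj₁ (ends F i))) (w (proj₂ (ends F i))))

  old-edge : ∀ i → OldEdge i
  old-edge i with z ∈? f i
  ... | no z∉fi = f i , f∈A i , Trace-◃ (trace i) z∉fi
  ... | yes z∈fi = f i [ z ≔ new E ] , exchanged∈A E
                 , Trace-◃ (Trace-exchange (trace i) z∉w (∉W⇒¬Image (new∉B E ∘ there))) z∉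
    where
    E : Exchange (f i) z (z ∷ W)
    E = exchange-unembedded (f∈A i) z∈fi z∉w (trace i) (proj₁ simple i ∘ w-inj)
    z∉ : z ∉ f i [ z ≔ new E ]
    z∉ z∈ with ∈-exchange⁻ z∈
    ... | inj₁ z≡new = new∉B E (here (sym z≡new))
    ... | inj₂ (_ , z≢z) = z≢z refl

  w⁺ : Fin (p (plus F j)) → Fin n
  w⁺ = z ◃ w

  f⁺ : Fin (q (plus F j)) → Subset n
  f⁺ zero          = g [ w y ≔ new zx ]
  f⁺ (suc zero)    = g [ w x ≔ new zy ]
  f⁺ (suc (suc i)) = proj₁ (old-edge i)

  f⁺∈A : ∀ i → f⁺ i ∈ₑ A
  f⁺∈A zero          = exchanged∈A zx
  f⁺∈A (suc zero)    = exchanged∈A zy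
  f⁺∈A (suc (suc i)) = proj₁ (proj₂ (old-edge i))

  trace⁺ : ∀ i → Trace w⁺ (f⁺ i) (w⁺ (proj₁ (ends (plus F j) i))) (w⁺ (proj₂ (ends (plus F j) i)))
  trace⁺ zero          = Trace-exchange-endpoint trace-g ∈-exchange⁺ʳ z∉w (∉W⇒¬Image (new∉B zx)) wx≢wy
  trace⁺ (suc zero)    =
    Trace-exchange-endpoint (Trace-sym trace-g) ∈-exchange⁺ʳ z∉w (∉W⇒¬Image (new∉B zy)) (wx≢wy ∘ sym)
  trace⁺ (suc (suc i)) = proj₂ (proj₂ (old-edge i))

  w⁺-injective : Injective _≡_ _≡_ w⁺
  w⁺-injective = ◃-injective w-inj z∉w

  inducedBerge⁺ : InducedBerge (plus F j) A
  inducedBerge⁺ = w⁺ , f⁺ , w⁺-injective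
                , Trace-injective (plus F j) (plus-simple F j simple) w⁺-injective trace⁺
                , f⁺∈A , trace⁺

claim3p4 : (n r α : ℕ) → 3 ≤ r → 1 ≤ α →
    (part : Fin n → Fin r) (H A : Family n) →
    IsUniformPartite r part H → A ⊑ H → IsCore r α A →
    (F : Graph) → IsSimple F → 1 ≤ q F → p F ≤ α →
    InducedBerge F A →
    (j : Fin (q F)) → InducedBerge (plus F j) A
claim3p4 n r α r≥3 _ part H A partite A⊑H core F simple _ p≤α (w , f , w-inj , _ , f∈A , trace) j =
  Extension.inducedBerge⁺ r≥3 part H A partite A⊑H core F simple p≤α w f w-inj f∈A trace j
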